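{- Let $m\ge2$ and let $\Delta$ be a graph with vertex set $\{1,-1,2,-2,\dots,m,-m\}$ whose automorphism group contains the group $Z=\langle\tau\rangle\times\mathrm{Sym}(m)$. Then $\Delta$ is isomorphic to $K_m\square K_2$, $K_{m,m}$, $mK_2$, $K_{2m}$, or the complement of one of these. Moreover, if $\mu(\Delta)=4$, then $m\ge3$ and $\Delta$ is isomorphic to $K_m\square K_2$ or to $\overline{K_m\square K_2}$.
   Context: Here $\mathrm{Sym}(m)$ acts on $\{\pm1,\dots,\pm m\}$ by $\varepsilon i\mapsto\varepsilon\,\sigma(i)$ ($\varepsilon\in\{1,-1\}$, $i\in[m]$, $\sigma\in\mathrm{Sym}(m)$), $\tau$ is the map $x\mapsto -x$, and $Z$ is the group generated by $\tau$ and this copy of $\mathrm{Sym}(m)$. $\mu(\Delta)$ is the motion of $\Delta$: the minimum number of vertices moved by a non-identity automorphism. $\square$ denotes the Cartesian product, $K_{m,m}$ the complete bipartite graph, $mK_2$ a perfect matching on $2m$ vertices, and overline the complement. -}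

module Defs where

open import Data.Nat using (ℕ; _≤_)
open import Data.Bool using (Bool; true; false; not; _xor_; _∧_; _∨_)
open import Data.Fin using (Fin)
open import Data.Fin.Properties using () renaming (_≟_ to _≟F_)
open import Data.Fin.Permutation using (Permutation′; _⟨$⟩ʳ_)
open import Data.Product using (Σ; _×_; _,_; proj₁; proj₂; ∃)
open import Data.Product.Properties using (≡-dec)
open import Data.Bool.Properties using () renaming (_≟_ to _≟B_)
open import Data.List using (List; []; _∷_; length; filter; allFin; cartesianProduct)
open import Relation.Nullary using (¬_; Dec; yes; no)
open import Relation.Nullary.Decidable using (⌊_⌋)
open import Relation.Binary.PropositionalEquality using (_≡_; _≢_)
open import Function.Bundles using (_↔_; Inverse)

record Graph (V : Set) : Set where
  field
    adj    : V → V → Bool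
    sym    : ∀ u v → adj u v ≡ adj v u
    irrefl : ∀ v → adj v v ≡ false
open Graph public

-- Vertex set {±1,…,±m}: vertex εi is encoded as (i , b) with b = true for ε = +1,
-- b = false for ε = -1.
Vtx : ℕ → Set
Vtx m = Fin m × Bool

_≟V_ : ∀ {m} → (u v : Vtx m) → Dec (u ≡ v)
_≟V_ = ≡-dec _≟F_ _≟B_

allVtx : (m : ℕ) → List (Vtx m)
allVtx m = cartesianProduct (allFin m) (true ∷ false ∷ [])

-- Isomorphism of a graph G onto the graph with adjacency function H
-- (the standard graphs below are given by their adjacency functions)
Iso : ∀ {V W : Set} → Graph V → (W → W → Bool) → Set
Iso {V} {W} G H = Σ (V ↔ W) λ f →
  ∀ u v → H (Inverse.to f u) (Inverse.to f v) ≡ adj G u v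

IsAut : ∀ {V : Set} → Graph V → (V → V) → Set
IsAut G f = ∀ u v → adj G (f u) (f v) ≡ adj G u v

Aut : ∀ {V : Set} → Graph V → Set
Aut {V} G = Σ (V ↔ V) λ f → IsAut G (Inverse.to f)

-- Elements of Z = ⟨τ⟩ × Sym(m): εi ↦ (±)ε σ(i); the flag c says whether τ is applied.
zAct : ∀ {m} → Permutation′ m → Bool → Vtx m → Vtx m
zAct σ c (i , b) = (σ ⟨$⟩ʳ i , b xor c)

ContainsZ : ∀ {m} → Graph (Vtx m) → Set
ContainsZ Δ = ∀ σ c → IsAut Δ (zAct σ c)

moved : ∀ {m} → (Vtx m → Vtx m) → ℕ
moved {m} f = length (filter (λ v → Relation.Nullary.¬? (f v ≟V v)) (allVtx m))

NonIdentity : ∀ {m} → (Vtx m → Vtx m) → Set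
NonIdentity {m} f = ∃ λ (v : Vtx m) → f v ≢ v

MotionIs : ∀ {m} → Graph (Vtx m) → ℕ → Set
MotionIs Δ k =
  (Σ (Aut Δ) λ a → NonIdentity (Inverse.to (proj₁ a)) × moved (Inverse.to (proj₁ a)) ≡ k)
  × (∀ (a : Aut Δ) → NonIdentity (Inverse.to (proj₁ a)) → k ≤ moved (Inverse.to (proj₁ a)))

eqF : ∀ {m} → Fin m → Fin m → Bool
eqF i j = ⌊ i ≟F j ⌋

eqB : Bool → Bool → Bool
eqB a b = ⌊ a ≟B b ⌋

neqV : ∀ {m} → Vtx m → Vtx m → Bool
neqV u v = not ⌊ u ≟V v ⌋

KmBoxK2-adj : ∀ {m} → Vtx m → Vtx m → Bool
KmBoxK2-adj (i , a) (j , b) = (eqF i j ∧ not (eqB a b)) ∨ (eqB a b ∧ not (eqF i j))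

Kmm-adj : ∀ {m} → Vtx m → Vtx m → Bool
Kmm-adj (i , a) (j , b) = not (eqB a b)

mK2-adj : ∀ {m} → Vtx m → Vtx m → Bool
mK2-adj (i , a) (j , b) = eqF i j ∧ not (eqB a b)

K2m-adj : ∀ {m} → Vtx m → Vtx m → Bool
K2m-adj u v = neqV u v

compl : ∀ {m} → (Vtx m → Vtx m → Bool) → Vtx m → Vtx m → Bool
compl H u v = neqV u v ∧ not (H u v)

{-# OPTIONS --safe #-}
module Submission where

-- The group Z has exactly three orbits on pairs of distinct vertices: {i, -i}, {εi, εj} and
-- {εi, -εj} with i ≠ j (Sym(m) is 2-transitive and τ flips both signs). A Z-invariant graph is
-- therefore a union of orbits, and the 2³ unions are the eight listed graphs. If μ(Δ) = 4 there
-- are no twins (distinct vertices with the same neighbours apart from each other), since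
-- swapping two twins is an automorphism moving 2 vertices. But i and -i are twins unless exactly
-- one of the last two orbits is present, 1 and 2 are twins if the first and third orbits are
-- both present or both absent, and -1 and 2 are twins when m = 2 and the first two orbits agree;
-- only K_m □ K_2 and its complement with m ≥ 3 escape all three.

open import Defs
open import Data.Nat.Base using (ℕ; suc; 2+; _+_; _≤_; s≤s; z≤n)
open import Data.Bool.Base using (Bool; true; false; not; _∧_; _∨_)
open import Data.Bool.Properties using () renaming (_≟_ to _≟B_)
open import Data.Fin.Base using (Fin; suc)
open import Data.Fin.Patterns using (0F; 1F)
open import Data.Fin.Properties using () renaming (_≟_ to _≟F_)
open import Data.Fin.Permutation using (Permutation′; _⟨$⟩ʳ_; transpose; _∘ₚ_) renaming (id to idₚ)
import Data.Fin.Permutation.Components as PC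
open import Data.List.Base using (length; filter; tabulate; cartesianProduct; _∷_; [])
open import Data.List.Properties using (filter-none)
open import Data.List.Membership.Propositional using (_∈_)
open import Data.List.Membership.Propositional.Properties using (∈-cartesianProduct⁻; ∈-tabulate⁻)
import Data.List.Relation.Unary.All as All
open import Data.Product.Base using (∃; _×_; _,_; proj₁; proj₂)
open import Data.Sum.Base using (_⊎_; inj₁; inj₂)
open import Data.Empty using (⊥-elim)
open import Function.Bundles using (mk↔ₛ′)
open import Relation.Binary.Definitions using (DecidableEquality)
open import Relation.Binary.PropositionalEquality as ≡ using (_≡_; _≢_; refl; trans; cong)
open import Relation.Nullary using (¬_; yes; no; ¬?)
open import Relation.Nullary.Decidable using (⌊_⌋; ⌊⌋-map′; dec-true; dec-false)

transpose-matchˡ : ∀ {n} (i j : Fin n) → PC.transpose i j i ≡ j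
transpose-matchˡ i j rewrite dec-true (i ≟F i) refl = refl

transpose-fixes : ∀ {n} {i j k : Fin n} → k ≢ i → k ≢ j → PC.transpose i j k ≡ k
transpose-fixes {i = i} {j} {k} k≢i k≢j
  rewrite dec-false (k ≟F i) k≢i | dec-false (k ≟F j) k≢j = refl

Sym-2-transitive : ∀ {n} {i₀ j₀ i j : Fin n} → i₀ ≢ j₀ → i ≢ j →
  ∃ λ (σ : Permutation′ n) → σ ⟨$⟩ʳ i₀ ≡ i × σ ⟨$⟩ʳ j₀ ≡ j
Sym-2-transitive {i₀ = i₀} {j₀} {i} {j} i₀≢j₀ i≢j =
  transpose j₀ j′ ∘ₚ transpose i₀ i , sends-i₀ , sends-j₀
  where
  j′ : Fin _
  j′ = PC.transpose i i₀ j
  τj′≡j : PC.transpose i₀ i j′ ≡ j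
  τj′≡j = PC.transpose-inverse i₀ i
  i₀≢j′ : i₀ ≢ j′
  i₀≢j′ i₀≡j′ =
    i≢j (trans (≡.sym (transpose-matchˡ i₀ i)) (trans (cong (PC.transpose i₀ i) i₀≡j′) τj′≡j))
  sends-i₀ : PC.transpose i₀ i (PC.transpose j₀ j′ i₀) ≡ i
  sends-i₀ = trans (cong (PC.transpose i₀ i) (transpose-fixes i₀≢j₀ i₀≢j′)) (transpose-matchˡ i₀ i)
  sends-j₀ : PC.transpose i₀ i (PC.transpose j₀ j′ j₀) ≡ j
  sends-j₀ = trans (cong (PC.transpose i₀ i) (transpose-matchˡ j₀ j′)) τj′≡j

pairTypeAdj : ∀ {m} → (Bool → Bool → Bool) → Vtx m → Vtx m → Bool
pairTypeAdj h (i , x) (j , y) = h (eqF i j) (eqB x y)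

-- a, b, c say whether the orbits {i, -i}, {εi, εj} and {εi, -εj} (i ≠ j) are edges;
-- the last two arguments tell whether a pair has the same index and the same sign.
orbitals : Bool → Bool → Bool → Bool → Bool → Bool
orbitals a b c true  true  = false
orbitals a b c true  false = a
orbitals a b c false true  = b
orbitals a b c false false = c

module ZInvariant {k} (Δ : Graph (Vtx (2+ k))) (Z : ContainsZ Δ) where

  antipodalAdj sameSignAdj crossSignAdj : Bool
  antipodalAdj = adj Δ (0F , false) (0F , true)
  sameSignAdj  = adj Δ (0F , false) (1F , false)
  crossSignAdj = adj Δ (0F , false) (1F , true)

  Δ-pattern : Bool → Bool → Bool
  Δ-pattern = orbitals antipodalAdj sameSignAdj crossSignAdj

  -- The signs are split so that x xor false computes.
  adj-relabel : ∀ (σ : Permutation′ (2+ k)) i j x y →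
    adj Δ (σ ⟨$⟩ʳ i , x) (σ ⟨$⟩ʳ j , y) ≡ adj Δ (i , x) (j , y)
  adj-relabel σ i j false false = Z σ false (i , false) (j , false)
  adj-relabel σ i j false true  = Z σ false (i , false) (j , true)
  adj-relabel σ i j true  false = Z σ false (i , true)  (j , false)
  adj-relabel σ i j true  true  = Z σ false (i , true)  (j , true)

  adj-transport : ∀ (σ : Permutation′ (2+ k)) {i₀ j₀ i j} x y →
    σ ⟨$⟩ʳ i₀ ≡ i → σ ⟨$⟩ʳ j₀ ≡ j → adj Δ (i , x) (j , y) ≡ adj Δ (i₀ , x) (j₀ , y)
  adj-transport σ {i₀} {j₀} x y refl refl = adj-relabel σ i₀ j₀ x y

  adj-sameIndex : ∀ i x y → adj Δ (i , x) (i , y) ≡ Δ-pattern true (eqB x y)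
  adj-sameIndex i x y =
    trans (adj-transport (transpose 0F i) x y (transpose-matchˡ 0F i) (transpose-matchˡ 0F i))
          (at-0 x y)
    where
    at-0 : ∀ x y → adj Δ (0F , x) (0F , y) ≡ Δ-pattern true (eqB x y)
    at-0 false false = irrefl Δ _
    at-0 false true  = refl
    at-0 true  false = sym Δ _ _
    at-0 true  true  = irrefl Δ _

  adj-distinctIndex : ∀ {i j} → i ≢ j → ∀ x y → adj Δ (i , x) (j , y) ≡ Δ-pattern false (eqB x y)
  adj-distinctIndex i≢j x y =
    let (σ , σ0≡i , σ1≡j) = Sym-2-transitive {i₀ = 0F} {j₀ = 1F} (λ ()) i≢j
    in trans (adj-transport σ x y σ0≡i σ1≡j) (at-01 x y)
    where
    at-01 : ∀ x y → adj Δ (0F , x) (1F , y) ≡ Δ-pattern false (eqB x y)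
    at-01 false false = refl
    at-01 false true  = refl
    at-01 true  false = ≡.sym (Z idₚ true (0F , true) (1F , false))
    at-01 true  true  = ≡.sym (Z idₚ true (0F , true) (1F , true))

  adj-orbitals : ∀ u v → adj Δ u v ≡ pairTypeAdj Δ-pattern u v
  adj-orbitals (i , x) (j , y) with i ≟F j
  ... | yes refl = adj-sameIndex i x y
  ... | no i≢j   = adj-distinctIndex i≢j x y

orbitals-complete : (h : Bool → Bool → Bool) → h true true ≡ false →
  ∀ e s → h e s ≡ orbitals (h true false) (h false true) (h false false) e s
orbitals-complete h h-irrefl true  true  = h-irrefl
orbitals-complete h h-irrefl true  false = refl
orbitals-complete h h-irrefl false true  = refl
orbitals-complete h h-irrefl false false = refl

⌊≟V⌋≡eqF∧eqB : ∀ {m} (u v : Vtx m) → ⌊ u ≟V v ⌋ ≡ eqF (proj₁ u) (proj₁ v) ∧ eqB (proj₂ u) (proj₂ v)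
⌊≟V⌋≡eqF∧eqB (i , x) (j , y) with i ≟F j
... | yes refl = ⌊⌋-map′ _ _ (x ≟B y)
... | no  _    = refl

KmBoxK2-orbitals : ∀ {m} (u v : Vtx m) →
  KmBoxK2-adj u v ≡ pairTypeAdj (orbitals true true false) u v
KmBoxK2-orbitals (i , x) (j , y) =
  orbitals-complete (λ e s → (e ∧ not s) ∨ (s ∧ not e)) refl (eqF i j) (eqB x y)

Kmm-orbitals : ∀ {m} (u v : Vtx m) → Kmm-adj u v ≡ pairTypeAdj (orbitals true false true) u v
Kmm-orbitals (i , x) (j , y) = orbitals-complete (λ e s → not s) refl (eqF i j) (eqB x y)

mK2-orbitals : ∀ {m} (u v : Vtx m) → mK2-adj u v ≡ pairTypeAdj (orbitals true false false) u v
mK2-orbitals (i , x) (j , y) = orbitals-complete (λ e s → e ∧ not s) refl (eqF i j) (eqB x y)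

K2m-orbitals : ∀ {m} (u v : Vtx m) → K2m-adj u v ≡ pairTypeAdj (orbitals true true true) u v
K2m-orbitals (i , x) (j , y) =
  trans (cong not (⌊≟V⌋≡eqF∧eqB (i , x) (j , y)))
        (orbitals-complete (λ e s → not (e ∧ s)) refl (eqF i j) (eqB x y))

compl-orbitals : ∀ {m} {H : Vtx m → Vtx m → Bool} {a b c} →
  (∀ u v → H u v ≡ pairTypeAdj (orbitals a b c) u v) →
  ∀ u v → compl H u v ≡ pairTypeAdj (orbitals (not a) (not b) (not c)) u v
compl-orbitals {H = H} {a} {b} {c} H-orbitals (i , x) (j , y) = begin
  not ⌊ (i , x) ≟V (j , y) ⌋ ∧ not (H (i , x) (j , y))
    ≡⟨ ≡.cong₂ (λ d h → not d ∧ not h) (⌊≟V⌋≡eqF∧eqB (i , x) (j , y)) (H-orbitals (i , x) (j , y)) ⟩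
  not (eqF i j ∧ eqB x y) ∧ not (orbitals a b c (eqF i j) (eqB x y))
    ≡⟨ orbitals-complete (λ e s → not (e ∧ s) ∧ not (orbitals a b c e s)) refl (eqF i j) (eqB x y) ⟩
  orbitals (not a) (not b) (not c) (eqF i j) (eqB x y) ∎
  where open ≡.≡-Reasoning

identityIso : ∀ {V} {G : Graph V} {H : V → V → Bool} → (∀ u v → H u v ≡ adj G u v) → Iso G H
identityIso H≡G = mk↔ₛ′ (λ v → v) (λ v → v) (λ _ → refl) (λ _ → refl) , H≡G

IsoToStandardZGraph : ∀ {m} → Graph (Vtx m) → Set
IsoToStandardZGraph {m} Δ =
  Iso Δ (KmBoxK2-adj {m}) ⊎ Iso Δ (Kmm-adj {m}) ⊎ Iso Δ (mK2-adj {m}) ⊎ Iso Δ (K2m-adj {m})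
  ⊎ Iso Δ (compl (KmBoxK2-adj {m})) ⊎ Iso Δ (compl (Kmm-adj {m}))
  ⊎ Iso Δ (compl (mK2-adj {m})) ⊎ Iso Δ (compl (K2m-adj {m}))

module _ {m} (Δ : Graph (Vtx m)) where

  iso-sameOrbitals : ∀ {H : Vtx m → Vtx m → Bool} {a b c} →
    (∀ u v → adj Δ u v ≡ pairTypeAdj (orbitals a b c) u v) →
    (∀ u v → H u v ≡ pairTypeAdj (orbitals a b c) u v) → Iso Δ H
  iso-sameOrbitals Δ-orbitals H-orbitals =
    identityIso {G = Δ} λ u v → trans (H-orbitals u v) (≡.sym (Δ-orbitals u v))

  orbitals-classification : ∀ a b c →
    (∀ u v → adj Δ u v ≡ pairTypeAdj (orbitals a b c) u v) → IsoToStandardZGraph Δ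
  orbitals-classification true  true  false Δ≗ =
    inj₁ (iso-sameOrbitals Δ≗ KmBoxK2-orbitals)
  orbitals-classification true  false true  Δ≗ =
    inj₂ (inj₁ (iso-sameOrbitals Δ≗ Kmm-orbitals))
  orbitals-classification true  false false Δ≗ =
    inj₂ (inj₂ (inj₁ (iso-sameOrbitals Δ≗ mK2-orbitals)))
  orbitals-classification true  true  true  Δ≗ =
    inj₂ (inj₂ (inj₂ (inj₁ (iso-sameOrbitals Δ≗ K2m-orbitals))))
  orbitals-classification false false true  Δ≗ =
    inj₂ (inj₂ (inj₂ (inj₂ (inj₁ (iso-sameOrbitals Δ≗ (compl-orbitals KmBoxK2-orbitals))))))
  orbitals-classification false true  false Δ≗ =
    inj₂ (inj₂ (inj₂ (inj₂ (inj₂ (inj₁ (iso-sameOrbitals Δ≗ (compl-orbitals Kmm-orbitals)))))))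
  orbitals-classification false true  true  Δ≗ =
    inj₂ (inj₂ (inj₂ (inj₂ (inj₂ (inj₂ (inj₁ (iso-sameOrbitals Δ≗ (compl-orbitals mK2-orbitals))))))))
  orbitals-classification false false false Δ≗ =
    inj₂ (inj₂ (inj₂ (inj₂ (inj₂ (inj₂ (inj₂ (iso-sameOrbitals Δ≗ (compl-orbitals K2m-orbitals))))))))

module _ {V : Set} (_≟_ : DecidableEquality V) where

  swap : V → V → V → V
  swap u v w with w ≟ u | w ≟ v
  ... | yes _ | _     = v
  ... | no _  | yes _ = u
  ... | no _  | no _  = w

  module _ {u v : V} where

    swap-left : swap u v u ≡ v
    swap-left with u ≟ u
    ... | yes _   = refl
    ... | no u≢u  = ⊥-elim (u≢u refl)

    swap-right : swap u v v ≡ u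
    swap-right with v ≟ u | v ≟ v
    ... | yes v≡u | _      = v≡u
    ... | no _    | yes _  = refl
    ... | no _    | no v≢v = ⊥-elim (v≢v refl)

    swap-fixes : ∀ {w} → w ≢ u → w ≢ v → swap u v w ≡ w
    swap-fixes {w} w≢u w≢v with w ≟ u | w ≟ v
    ... | yes w≡u | _       = ⊥-elim (w≢u w≡u)
    ... | no _    | yes w≡v = ⊥-elim (w≢v w≡v)
    ... | no _    | no _    = refl

    position : ∀ w → w ≡ u ⊎ w ≡ v ⊎ (w ≢ u × w ≢ v)
    position w with w ≟ u | w ≟ v
    ... | yes w≡u | _       = inj₁ w≡u
    ... | no _    | yes w≡v = inj₂ (inj₁ w≡v)
    ... | no w≢u  | no w≢v  = inj₂ (inj₂ (w≢u , w≢v))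

    swap-involutive : ∀ w → swap u v (swap u v w) ≡ w
    swap-involutive w with position w
    ... | inj₁ refl               = trans (cong (swap u v) swap-left) swap-right
    ... | inj₂ (inj₁ refl)        = trans (cong (swap u v) swap-right) swap-left
    ... | inj₂ (inj₂ (w≢u , w≢v)) =
      trans (cong (swap u v) (swap-fixes w≢u w≢v)) (swap-fixes w≢u w≢v)

    module _ (G : Graph V) where

      Twins : Set
      Twins = ∀ w → w ≢ u → w ≢ v → adj G u w ≡ adj G v w

      swap-keepsNeighbour : Twins → ∀ x {w} → w ≢ u → w ≢ v → adj G (swap u v x) w ≡ adj G x w
      swap-keepsNeighbour twins x {w} w≢u w≢v with position x
      ... | inj₁ refl               rewrite swap-left          = ≡.sym (twins w w≢u w≢v)
      ... | inj₂ (inj₁ refl)        rewrite swap-right         = twins w w≢u w≢v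
      ... | inj₂ (inj₂ (x≢u , x≢v)) rewrite swap-fixes x≢u x≢v = refl

      swap-isAut : Twins → IsAut G (swap u v)
      swap-isAut twins x y with position x | position y
      ... | _ | inj₂ (inj₂ (y≢u , y≢v)) rewrite swap-fixes y≢u y≢v =
        swap-keepsNeighbour twins x y≢u y≢v
      ... | inj₂ (inj₂ (x≢u , x≢v)) | _ rewrite swap-fixes x≢u x≢v =
        trans (sym G x _) (trans (swap-keepsNeighbour twins y x≢u x≢v) (sym G y x))
      ... | inj₁ refl        | inj₁ refl        = trans (irrefl G _) (≡.sym (irrefl G u))
      ... | inj₂ (inj₁ refl) | inj₂ (inj₁ refl) = trans (irrefl G _) (≡.sym (irrefl G v))
      ... | inj₁ refl        | inj₂ (inj₁ refl) rewrite swap-left | swap-right = sym G v u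
      ... | inj₂ (inj₁ refl) | inj₁ refl        rewrite swap-left | swap-right = sym G u v

      swapAut : Twins → Aut G
      swapAut twins = mk↔ₛ′ (swap u v) (swap u v) swap-involutive swap-involutive , swap-isAut twins

filter-moved-none : ∀ {m n} {f : Vtx m → Vtx m} (g : Fin n → Fin m) →
  (∀ i x → f (g i , x) ≡ (g i , x)) →
  filter (λ w → ¬? (f w ≟V w)) (cartesianProduct (tabulate g) (true ∷ false ∷ [])) ≡ []
filter-moved-none {f = f} g fixes = filter-none (λ w → ¬? (f w ≟V w)) (All.tabulate fixed)
  where
  fixed : ∀ {w} → w ∈ cartesianProduct (tabulate g) (true ∷ false ∷ []) → ¬ (f w ≢ w)
  fixed {_ , x} w∈ with ∈-tabulate⁻ (proj₁ (∈-cartesianProduct⁻ (tabulate g) _ w∈))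
  ... | i , refl = λ f-moves → f-moves (fixes i x)

-- Vertices of index 0 and 1 are decided by evaluation; the block of higher indices is fixed.
moved-swap-signs : ∀ {k} → moved {2+ k} (swap _≟V_ (0F , true) (0F , false)) ≡ 2
moved-swap-signs {k} = cong (λ ws → 2 + length ws)
  (filter-moved-none {2+ k} {k} {f = swap _≟V_ (0F , true) (0F , false)} (λ i → suc (suc i))
                     (λ i x → refl))

moved-swap-indices : ∀ {k} → moved {2+ k} (swap _≟V_ (0F , true) (1F , true)) ≡ 2
moved-swap-indices {k} = cong (λ ws → 2 + length ws)
  (filter-moved-none {2+ k} {k} {f = swap _≟V_ (0F , true) (1F , true)} (λ i → suc (suc i))
                     (λ i x → refl))

moved-swap-cross : moved {2} (swap _≟V_ (0F , false) (1F , true)) ≡ 2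
moved-swap-cross = refl

twins⇒¬motion4 : ∀ {m} (Δ : Graph (Vtx m)) {u v} → u ≢ v → Twins _≟V_ {u} {v} Δ →
  moved (swap _≟V_ u v) ≡ 2 → ¬ MotionIs Δ 4
twins⇒¬motion4 Δ {u} u≢v twins moved≡2 (_ , minimal) =
  4≰2 (≡.subst (4 ≤_) moved≡2 (minimal (swapAut _≟V_ Δ twins) (u , swap-u≢u)))
  where
  swap-u≢u : swap _≟V_ u _ u ≢ u
  swap-u≢u swap-u≡u = u≢v (trans (≡.sym swap-u≡u) (swap-left _≟V_))
  4≰2 : ¬ 4 ≤ 2
  4≰2 (s≤s (s≤s ()))

module _ {k} (Δ : Graph (Vtx (2+ k))) {a b c}
         (Δ-orbitals : ∀ u v → adj Δ u v ≡ pairTypeAdj (orbitals a b c) u v) where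

  adj-viaOrbitals : ∀ {u v w} →
    pairTypeAdj (orbitals a b c) u w ≡ pairTypeAdj (orbitals a b c) v w →
    adj Δ u w ≡ adj Δ v w
  adj-viaOrbitals {u} {v} {w} same = trans (Δ-orbitals u w) (trans same (≡.sym (Δ-orbitals v w)))

  signTwins : b ≡ c → Twins _≟V_ {0F , true} {0F , false} Δ
  signTwins b≡c (0F , true)    w≢u _   = ⊥-elim (w≢u refl)
  signTwins b≡c (0F , false)   _   w≢v = ⊥-elim (w≢v refl)
  signTwins b≡c (suc j , true)  _ _    = adj-viaOrbitals b≡c
  signTwins b≡c (suc j , false) _ _    = adj-viaOrbitals (≡.sym b≡c)

  indexTwins : a ≡ c → Twins _≟V_ {0F , true} {1F , true} Δ
  indexTwins a≡c (0F , true)        w≢u _   = ⊥-elim (w≢u refl)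
  indexTwins a≡c (0F , false)       _   _   = adj-viaOrbitals a≡c
  indexTwins a≡c (1F , true)        _   w≢v = ⊥-elim (w≢v refl)
  indexTwins a≡c (1F , false)       _   _   = adj-viaOrbitals (≡.sym a≡c)
  indexTwins a≡c (suc (suc j) , y)  _   _   = adj-viaOrbitals refl

  crossTwins : k ≡ 0 → a ≡ b → Twins _≟V_ {0F , false} {1F , true} Δ
  crossTwins refl a≡b (0F , true)  _   _   = adj-viaOrbitals a≡b
  crossTwins refl a≡b (0F , false) w≢u _   = ⊥-elim (w≢u refl)
  crossTwins refl a≡b (1F , true)  _   w≢v = ⊥-elim (w≢v refl)
  crossTwins refl a≡b (1F , false) _   _   = adj-viaOrbitals (≡.sym a≡b)

  signTwins-¬motion4 : b ≡ c → ¬ MotionIs Δ 4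
  signTwins-¬motion4 b≡c = twins⇒¬motion4 Δ (λ ()) (signTwins b≡c) (moved-swap-signs {k})

  indexTwins-¬motion4 : a ≡ c → ¬ MotionIs Δ 4
  indexTwins-¬motion4 a≡c = twins⇒¬motion4 Δ (λ ()) (indexTwins a≡c) (moved-swap-indices {k})

  crossTwins-¬motion4 : k ≡ 0 → a ≡ b → ¬ MotionIs Δ 4
  crossTwins-¬motion4 refl a≡b = twins⇒¬motion4 Δ (λ ()) (crossTwins refl a≡b) moved-swap-cross

motion4-classification : ∀ k (Δ : Graph (Vtx (2+ k))) a b c →
  (∀ u v → adj Δ u v ≡ pairTypeAdj (orbitals a b c) u v) → MotionIs Δ 4 →
  3 ≤ 2+ k × (Iso Δ (KmBoxK2-adj {2+ k}) ⊎ Iso Δ (compl (KmBoxK2-adj {2+ k})))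
motion4-classification k       Δ true  true  true  Δ≗ μ = ⊥-elim (signTwins-¬motion4 Δ Δ≗ refl μ)
motion4-classification k       Δ false true  true  Δ≗ μ = ⊥-elim (signTwins-¬motion4 Δ Δ≗ refl μ)
motion4-classification k       Δ true  false false Δ≗ μ = ⊥-elim (signTwins-¬motion4 Δ Δ≗ refl μ)
motion4-classification k       Δ false false false Δ≗ μ = ⊥-elim (signTwins-¬motion4 Δ Δ≗ refl μ)
motion4-classification k       Δ true  false true  Δ≗ μ = ⊥-elim (indexTwins-¬motion4 Δ Δ≗ refl μ)
motion4-classification k       Δ false true  false Δ≗ μ = ⊥-elim (indexTwins-¬motion4 Δ Δ≗ refl μ)
motion4-classification 0       Δ true  true  false Δ≗ μ = ⊥-elim (crossTwins-¬motion4 Δ Δ≗ refl refl μ)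
motion4-classification 0       Δ false false true  Δ≗ μ = ⊥-elim (crossTwins-¬motion4 Δ Δ≗ refl refl μ)
motion4-classification (suc k) Δ true  true  false Δ≗ μ =
  s≤s (s≤s (s≤s z≤n)) , inj₁ (iso-sameOrbitals Δ Δ≗ KmBoxK2-orbitals)
motion4-classification (suc k) Δ false false true  Δ≗ μ =
  s≤s (s≤s (s≤s z≤n)) , inj₂ (iso-sameOrbitals Δ Δ≗ (compl-orbitals KmBoxK2-orbitals))

lemma3p10 : ∀ (m : ℕ) → 2 ≤ m → (Δ : Graph (Vtx m)) → ContainsZ Δ →
    (Iso Δ (KmBoxK2-adj {m}) ⊎ Iso Δ (Kmm-adj {m}) ⊎ Iso Δ (mK2-adj {m}) ⊎ Iso Δ (K2m-adj {m})
      ⊎ Iso Δ (compl (KmBoxK2-adj {m})) ⊎ Iso Δ (compl (Kmm-adj {m}))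
      ⊎ Iso Δ (compl (mK2-adj {m})) ⊎ Iso Δ (compl (K2m-adj {m})))
    × (MotionIs Δ 4 → 3 ≤ m × (Iso Δ (KmBoxK2-adj {m}) ⊎ Iso Δ (compl (KmBoxK2-adj {m}))))
lemma3p10 (2+ k) (s≤s (s≤s z≤n)) Δ Z =
  orbitals-classification Δ _ _ _ adj-orbitals , motion4-classification k Δ _ _ _ adj-orbitals
  where open ZInvariant Δ Z
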